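{- Fix integers $a,b,c\ge0$ with either $a\le c\le 2a$ or $c<a\le b+c$. Let $\rho\in\{0,1\}$ be the parity of $c$. For integers $x,y\ge0$ define $m(x,y)$ as follows: if $a\le c\le 2a$, it is the number of triples $(d,e,f)$ of nonnegative integers with $d\le 2a-c$, $e\le b$, $x=b+d-e+f$, $y=e+f$; if $c<a\le b+c$, it is the number of triples $(d,e,f)$ of nonnegative integers with $d\le c$, $e\le -a+b+c$, $x=-a+b+c+d-e+f$, $y=e+f$. Define $n(x,y)$ as the number of $7$-tuples of integers $(k,m,n,\epsilon,\alpha,\beta,i)$ with $k,m,n\ge0$, $\epsilon\in\{0,1\}$, satisfying $m\le\alpha\le m+n$; $\underline\epsilon\le\beta\le m$, where $\underline\epsilon=\epsilon$ if $\rho=0$ and $\underline\epsilon=0$ if $\rho=1$; $0\le i\le\min(\alpha-\beta,\,k-2m-n+\alpha+\beta-\epsilon)$; and $2m+\rho=2a-c$, $2\alpha+k-n-2m-\epsilon-2i=b$, $2\beta+2i+\rho=c$, together with $k=c-a+x$ and $2m+2n+\rho=c+2y$ in the case $a\le c\le 2a$, or $k=a-c+x$ and $2m+2n+\rho=2a-c+2y$ in the case $c<a\le b+c$. Then $m(x,y)=n(x,y)$ for all integers $x,y\ge0$. -}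

module Defs where

open import Data.Nat as ℕ using (ℕ)
open import Data.Nat.DivMod using (_%_)
open import Data.Integer using (ℤ; +_; _+_; _-_; _*_; _≤_; _<_; _⊓_; 0ℤ; 1ℤ)
open import Data.Product using (Σ; _×_; _,_)
open import Data.Sum using (_⊎_)
open import Data.List using (List; length)
open import Data.List.Membership.Propositional using (_∈_)
open import Data.List.Relation.Unary.Unique.Propositional using (Unique)
open import Function.Bundles using (_⇔_)
open import Relation.Binary.PropositionalEquality using (_≡_)

HasCount : {A : Set} → (A → Set) → ℕ → Set
HasCount {A} P N =
  Σ (List A) λ l → Unique l × ((t : A) → (t ∈ l) ⇔ P t) × length l ≡ N

Case : ℕ → ℕ → ℕ → Set
Case a b c = (a ℕ.≤ c × c ℕ.≤ 2 ℕ.* a) ⊎ (c ℕ.< a × a ℕ.≤ b ℕ.+ c)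

ρ : ℕ → ℤ
ρ c = + (c % 2)

ℤ³ : Set
ℤ³ = ℤ × ℤ × ℤ

ℤ⁷ : Set
ℤ⁷ = ℤ × ℤ × ℤ × ℤ × ℤ × ℤ × ℤ

MSet₁ : (a b c x y : ℕ) → ℤ³ → Set
MSet₁ a b c x y (d , e , f) =
  0ℤ ≤ d × 0ℤ ≤ e × 0ℤ ≤ f ×
  d ≤ + 2 * + a - + c × e ≤ + b ×
  + x ≡ + b + d - e + f × + y ≡ e + f

MSet₂ : (a b c x y : ℕ) → ℤ³ → Set
MSet₂ a b c x y (d , e , f) =
  0ℤ ≤ d × 0ℤ ≤ e × 0ℤ ≤ f ×
  d ≤ + c × e ≤ - + a + + b + + c ×
  + x ≡ - + a + + b + + c + d - e + f × + y ≡ e + f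
  where open Data.Integer using (-_)

εlow : ℕ → ℤ → ℤ
εlow c ε with c % 2
... | ℕ.zero = ε
... | ℕ.suc _ = 0ℤ

NCommon : (a b c : ℕ) → ℤ⁷ → Set
NCommon a b c (k , m , n , ε , α , β , i) =
  0ℤ ≤ k × 0ℤ ≤ m × 0ℤ ≤ n × (ε ≡ 0ℤ ⊎ ε ≡ 1ℤ) ×
  m ≤ α × α ≤ m + n ×
  εlow c ε ≤ β × β ≤ m ×
  0ℤ ≤ i × i ≤ ((α - β) ⊓ (k - + 2 * m - n + α + β - ε)) ×
  + 2 * m + ρ c ≡ + 2 * + a - + c ×
  + 2 * α + k - n - + 2 * m - ε - + 2 * i ≡ + b ×
  + 2 * β + + 2 * i + ρ c ≡ + c

NSet₁ : (a b c x y : ℕ) → ℤ⁷ → Set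
NSet₁ a b c x y t@(k , m , n , ε , α , β , i) =
  NCommon a b c t ×
  k ≡ + c - + a + + x × + 2 * m + + 2 * n + ρ c ≡ + c + + 2 * + y

NSet₂ : (a b c x y : ℕ) → ℤ⁷ → Set
NSet₂ a b c x y t@(k , m , n , ε , α , β , i) =
  NCommon a b c t ×
  k ≡ + a - + c + + x × + 2 * m + + 2 * n + ρ c ≡ + 2 * + a - + c + + 2 * + y

MSet : (a b c : ℕ) → Case a b c → (x y : ℕ) → ℤ³ → Set
MSet a b c (Data.Sum.inj₁ _) = MSet₁ a b c
MSet a b c (Data.Sum.inj₂ _) = MSet₂ a b c

NSet : (a b c : ℕ) → Case a b c → (x y : ℕ) → ℤ⁷ → Set
NSet a b c (Data.Sum.inj₁ _) = NSet₁ a b c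
NSet a b c (Data.Sum.inj₂ _) = NSet₂ a b c

{-# OPTIONS --safe #-}
module Submission where

-- Write c = 2q + ρ and split the first coordinate of a triple (d, e, f) as
-- d = 2h + ε with ε ∈ {0, 1}.  The equations defining n(x, y) determine k, m, n
-- and β (m = a - q - ρ, β = q - i), and the remaining coordinates (ε, α, i) are
-- affine in (h, ε, e): i = h + c - a, α = q + e when a ≤ c ≤ 2a, and i = h,
-- α = e + m when c < a.  Under this change of variables every inequality of
-- n(x, y) is an inequality of m(x, y) up to a nonnegative shift; in particular
-- ε̲ ≤ β becomes the upper bound on d, because for ε ∈ {0, 1} one has
-- ε̲ ≤ β ⇔ ε ≤ 2β + ρ.  So both sets are in bijection, and m(x, y) is finite
-- since a triple is determined by e ∈ [0, y].

open import Defs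
open import Data.Empty using (⊥-elim)
open import Data.Integer as ℤ
  using (ℤ; +_; -[1+_]; -_; _+_; _-_; _*_; _≤_; _⊓_; 0ℤ; 1ℤ; ∣_∣; _≤?_; _≟_; _/ℕ_; _%ℕ_)
open import Data.Integer.DivMod using (a≡a%ℕn+[a/ℕn]*n; n%ℕd<d)
open import Data.Integer.Properties
  using (+-0-abelianGroup; ≤-trans; +-mono-≤; +-monoˡ-≤; *-monoˡ-≤-nonNeg; ⊓-glb; i⊓j≤i; i⊓j≤j;
         i≤j⇒0≤j-i; 0≤i-j⇒j≤i; *-cancelˡ-≡; 0≤i⇒+∣i∣≡i)
open import Data.Integer.Tactic.RingSolver using (solve; solve-∀)
open import Data.List using ([]; _∷_; map; filter; upTo)
open import Data.List.Membership.Propositional using (_∈_)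
open import Data.List.Membership.Propositional.Properties using (∈-map⁺; ∈-map⁻; ∈-filter⁺; ∈-filter⁻; ∈-upTo⁺)
open import Data.List.Properties using (length-map; map-id-local; map-∘)
open import Data.List.Relation.Unary.All as All using (All)
open import Data.List.Relation.Unary.Unique.Propositional using (Unique)
open import Data.List.Relation.Unary.Unique.Propositional.Properties using (filter⁺; upTo⁺; map⁻)
open import Data.Nat as ℕ using (ℕ; zero; suc; z≤n; s≤s; _<_)
open import Data.Nat.DivMod using (_%_; m%n<n)
open import Data.Nat.Properties using (m+1+n≢0; suc-injective; <⇒≤)
open import Algebra.Properties.AbelianGroup +-0-abelianGroup using (∙-cancelʳ)
open import Data.Product using (∃; _×_; _,_; proj₂)
open import Data.Sum using (_⊎_; inj₁; inj₂)
open import Function.Base using (_∘_)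
open import Function.Bundles using (_⇔_; mk⇔; Equivalence)
open import Relation.Nullary.Decidable using (_×-dec_)
open import Relation.Unary using (Decidable)
open import Relation.Binary.PropositionalEquality

record _↔ₚ_ {A B : Set} (P : A → Set) (Q : B → Set) : Set where
  field
    to      : A → B
    from    : B → A
    to-∈    : ∀ {t} → P t → Q (to t)
    from-∈  : ∀ {s} → Q s → P (from s)
    from∘to : ∀ {t} → P t → from (to t) ≡ t
    to∘from : ∀ {s} → Q s → to (from s) ≡ s

↔ₚ-trans : {A B C : Set} {P : A → Set} {Q : B → Set} {R : C → Set} →
  P ↔ₚ Q → Q ↔ₚ R → P ↔ₚ R
↔ₚ-trans f g = record
  { to      = G.to ∘ F.to
  ; from    = F.from ∘ G.from
  ; to-∈    = G.to-∈ ∘ F.to-∈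
  ; from-∈  = F.from-∈ ∘ G.from-∈
  ; from∘to = λ p → trans (cong F.from (G.from∘to (F.to-∈ p))) (F.from∘to p)
  ; to∘from = λ q → trans (cong G.to (F.to∘from (G.from-∈ q))) (G.to∘from q)
  }
  where module F = _↔ₚ_ f; module G = _↔ₚ_ g

HasCount-↔ₚ : {A B : Set} {P : A → Set} {Q : B → Set} {N : ℕ} →
  P ↔ₚ Q → HasCount P N → HasCount Q N
HasCount-↔ₚ {Q = Q} f (l , unique , ∈⇔ , length≡) =
  map to l , map-unique , map-∈⇔ , trans (length-map to l) length≡
  where
  open _↔ₚ_ f

  from-to-l : map from (map to l) ≡ l
  from-to-l = trans (sym (map-∘ l))
    (map-id-local (All.map from∘to (All.tabulate (Equivalence.to (∈⇔ _)))))

  map-unique : Unique (map to l)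
  map-unique = map⁻ {f = from} (subst Unique (sym from-to-l) unique)

  map-∈⇔ : ∀ s → (s ∈ map to l) ⇔ Q s
  map-∈⇔ s = mk⇔
    (λ s∈ → let t , t∈ , s≡ = ∈-map⁻ to s∈ in subst Q (sym s≡) (to-∈ (Equivalence.to (∈⇔ t) t∈)))
    (λ q → subst (_∈ map to l) (to∘from q) (∈-map⁺ to (Equivalence.from (∈⇔ _) (from-∈ q))))

HasCount-bounded : {P : ℕ → Set} → Decidable P → (B : ℕ) → (∀ {n} → P n → n < B) → ∃ (HasCount P)
HasCount-bounded P? B bound =
  _ , filter P? (upTo B) , filter⁺ P? {xs = upTo B} (upTo⁺ B) , ∈⇔ , refl
  where
  ∈⇔ : ∀ n → (n ∈ filter P? (upTo B)) ⇔ _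
  ∈⇔ n = mk⇔ (proj₂ ∘ ∈-filter⁻ P? {xs = upTo B}) (λ p → ∈-filter⁺ P? {xs = upTo B} (∈-upTo⁺ (bound p)) p)

infixr 4 _,≡_
_,≡_ : {A B : Set} {a a′ : A} {b b′ : B} → a ≡ a′ → b ≡ b′ → (a , b) ≡ (a′ , b′)
_,≡_ = cong₂ _,_

≤-by-gap : ∀ {i j g} → 0ℤ ≤ g → g ≡ j - i → i ≤ j
≤-by-gap 0≤g g≡ = 0≤i-j⇒j≤i (subst (0ℤ ≤_) g≡ 0≤g)

0≤-by-≡ : ∀ {j g} → 0ℤ ≤ g → g ≡ j → 0ℤ ≤ j
0≤-by-≡ 0≤g g≡ = subst (0ℤ ≤_) g≡ 0≤g

≤-⊓-by-gaps : ∀ {i j k g h} → 0ℤ ≤ g → g ≡ j - i → 0ℤ ≤ h → h ≡ k - i → i ≤ j ⊓ k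
≤-⊓-by-gaps 0≤g g≡ 0≤h h≡ = ⊓-glb (≤-by-gap 0≤g g≡) (≤-by-gap 0≤h h≡)

Bit : ℤ → Set
Bit ε = ε ≡ 0ℤ ⊎ ε ≡ 1ℤ

bit-nonneg : ∀ {ε} → Bit ε → 0ℤ ≤ ε
bit-nonneg (inj₁ refl) = ℤ.+≤+ z≤n
bit-nonneg (inj₂ refl) = ℤ.+≤+ z≤n

2*-injective : ∀ {i j} → + 2 * i ≡ + 2 * j → i ≡ j
2*-injective {i} {j} = *-cancelˡ-≡ (+ 2) i j

2*i≢1 : ∀ i → + 2 * i ≢ 1ℤ
2*i≢1 (+ zero) ()
2*i≢1 (+ suc n) eq = m+1+n≢0 n (suc-injective (cong ∣_∣ eq))
2*i≢1 -[1+ n ] ()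

2*i+0≢2*j+1 : ∀ i j → + 2 * i + 0ℤ ≢ + 2 * j + 1ℤ
2*i+0≢2*j+1 i j eq = 2*i≢1 (i - j) (begin
  + 2 * (i - j)             ≡⟨ solve (i ∷ j ∷ []) ⟩
  + 2 * i + 0ℤ - + 2 * j    ≡⟨ cong (_- + 2 * j) eq ⟩
  + 2 * j + 1ℤ - + 2 * j    ≡⟨ solve (j ∷ []) ⟩
  1ℤ                        ∎)
  where open ≡-Reasoning

2*+bit-injective : ∀ {h h′ ε ε′} → Bit ε → Bit ε′ → + 2 * h + ε ≡ + 2 * h′ + ε′ → h ≡ h′ × ε ≡ ε′
2*+bit-injective (inj₁ refl) (inj₁ refl) eq = 2*-injective (∙-cancelʳ _ _ _ eq) , refl
2*+bit-injective (inj₂ refl) (inj₂ refl) eq = 2*-injective (∙-cancelʳ _ _ _ eq) , refl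
2*+bit-injective {h} {h′} (inj₁ refl) (inj₂ refl) eq = ⊥-elim (2*i+0≢2*j+1 h h′ eq)
2*+bit-injective {h} {h′} (inj₂ refl) (inj₁ refl) eq = ⊥-elim (2*i+0≢2*j+1 h′ h (sym eq))

0≤2i+1⇒0≤i : ∀ i → 0ℤ ≤ + 2 * i + 1ℤ → 0ℤ ≤ i
0≤2i+1⇒0≤i (+ n) _ = ℤ.+≤+ z≤n
0≤2i+1⇒0≤i -[1+ n ] 0≤2i+1
  with ≤-trans 0≤2i+1 (+-monoˡ-≤ 1ℤ (*-monoˡ-≤-nonNeg (+ 2) (ℤ.-≤- {m = n} {n = 0} z≤n)))
... | ()

0≤2i+bit⇒0≤i : ∀ {i ε} → Bit ε → 0ℤ ≤ + 2 * i + ε → 0ℤ ≤ i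
0≤2i+bit⇒0≤i {i} (inj₁ refl) 0≤2i = 0≤2i+1⇒0≤i i (≤-by-gap (+-mono-≤ 0≤2i (ℤ.+≤+ (z≤n {n = 1}))) (solve (i ∷ [])))
0≤2i+bit⇒0≤i {i} (inj₂ refl) 0≤2i+1 = 0≤2i+1⇒0≤i i 0≤2i+1

2m+r≡2a-c⇒m≡a-q-r : ∀ {a q r m} → + 2 * m + r ≡ + 2 * a - (+ 2 * q + r) → m ≡ a - q - r
2m+r≡2a-c⇒m≡a-q-r {a} {q} {r} {m} eq = 2*-injective (begin
  + 2 * m                      ≡⟨ solve (m ∷ r ∷ []) ⟩
  + 2 * m + r - r              ≡⟨ cong (_- r) eq ⟩
  + 2 * a - (+ 2 * q + r) - r  ≡⟨ solve (a ∷ q ∷ r ∷ []) ⟩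
  + 2 * (a - q - r)            ∎)
  where open ≡-Reasoning

2β+2i+r≡c⇒β≡q-i : ∀ {q r β i} → + 2 * β + + 2 * i + r ≡ + 2 * q + r → β ≡ q - i
2β+2i+r≡c⇒β≡q-i {q} {r} {β} {i} eq = 2*-injective (begin
  + 2 * β                              ≡⟨ solve (β ∷ i ∷ r ∷ []) ⟩
  + 2 * β + + 2 * i + r - + 2 * i - r  ≡⟨ cong (λ z → z - + 2 * i - r) eq ⟩
  + 2 * q + r - + 2 * i - r            ≡⟨ solve (q ∷ r ∷ i ∷ []) ⟩
  + 2 * (q - i)                        ∎)
  where open ≡-Reasoning

Halved : {A : Set} → (ℤ × A → Set) → ℤ × ℤ × A → Set
Halved P (h , ε , t) = Bit ε × P (+ 2 * h + ε , t)

%ℕ2-bit : ∀ d → Bit (+ (d %ℕ 2))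
%ℕ2-bit d with d %ℕ 2 | n%ℕd<d d 2
... | 0 | _ = inj₁ refl
... | 1 | _ = inj₂ refl
... | suc (suc _) | s≤s (s≤s ())

d≡2*[d/2]+d%2 : ∀ d → d ≡ + 2 * (d /ℕ 2) + + (d %ℕ 2)
d≡2*[d/2]+d%2 d = trans (a≡a%ℕn+[a/ℕn]*n d 2) (swap (+ (d %ℕ 2)) (d /ℕ 2))
  where
  swap : ∀ r q → r + q * + 2 ≡ + 2 * q + r
  swap = solve-∀

halving : {A : Set} {P : ℤ × A → Set} → P ↔ₚ Halved P
halving {P = P} = record
  { to      = λ (d , t) → d /ℕ 2 , + (d %ℕ 2) , t
  ; from    = λ (h , ε , t) → + 2 * h + ε , t
  ; to-∈    = λ {(d , t)} p → %ℕ2-bit d , subst (λ d → P (d , t)) (d≡2*[d/2]+d%2 d) p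
  ; from-∈  = proj₂
  ; from∘to = λ {(d , t)} _ → sym (d≡2*[d/2]+d%2 d) ,≡ refl
  ; to∘from = λ {(h , ε , t)} (bit , _) →
      let h≡ , ε≡ = 2*+bit-injective (%ℕ2-bit (+ 2 * h + ε)) bit (sym (d≡2*[d/2]+d%2 (+ 2 * h + ε)))
      in h≡ ,≡ ε≡ ,≡ refl
  }

-- MSet₁ and MSet₂ are the instances (D, O) = (2a - c, b) and (c, -a + b + c).
MSetℤ : (D O X Y : ℤ) → ℤ³ → Set
MSetℤ D O X Y (d , e , f) =
  0ℤ ≤ d × 0ℤ ≤ e × 0ℤ ≤ f × d ≤ D × e ≤ O × X ≡ O + d - e + f × Y ≡ e + f

MSetℤ? : ∀ D O X Y → Decidable (MSetℤ D O X Y)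
MSetℤ? D O X Y (d , e , f) =
  0ℤ ≤? d ×-dec 0ℤ ≤? e ×-dec 0ℤ ≤? f ×-dec d ≤? D ×-dec e ≤? O ×-dec
  X ≟ O + d - e + f ×-dec Y ≟ e + f

+n≤i⇒n≤∣i∣ : ∀ {n i} → + n ≤ i → n ℕ.≤ ∣ i ∣
+n≤i⇒n≤∣i∣ (ℤ.+≤+ n≤m) = n≤m

slice : (O X Y : ℤ) → ℕ → ℤ³
slice O X Y n = X - O + + n - (Y - + n) , + n , Y - + n

slice-∣e∣ : ∀ {D O X Y d e f} → MSetℤ D O X Y (d , e , f) → slice O X Y ∣ e ∣ ≡ (d , e , f)
slice-∣e∣ {O = O} {d = d} {e} {f} (_ , 0≤e , _ , _ , _ , refl , refl) rewrite 0≤i⇒+∣i∣≡i 0≤e =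
  solve (O ∷ d ∷ e ∷ f ∷ []) ,≡ refl ,≡ solve (e ∷ f ∷ [])

MSetℤ-count : ∀ D O X Y → ∃ (HasCount (MSetℤ D O X Y))
MSetℤ-count D O X Y =
  let N , count = HasCount-bounded (MSetℤ? D O X Y ∘ slice O X Y) (suc ∣ Y ∣) bound
  in N , HasCount-↔ₚ slicing count
  where
  bound : ∀ {n} → MSetℤ D O X Y (slice O X Y n) → n < suc ∣ Y ∣
  bound (_ , _ , 0≤f , _) = s≤s (+n≤i⇒n≤∣i∣ (0≤i-j⇒j≤i {Y} 0≤f))

  slicing : (MSetℤ D O X Y ∘ slice O X Y) ↔ₚ MSetℤ D O X Y
  slicing = record
    { to      = slice O X Y
    ; from    = λ (d , e , f) → ∣ e ∣
    ; to-∈    = λ p → p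
    ; from-∈  = λ p → subst (MSetℤ D O X Y) (sym (slice-∣e∣ p)) p
    ; from∘to = λ _ → refl
    ; to∘from = slice-∣e∣
    }

-- NCommon, NSet₁ and NSet₂ with the parameters (a, b, c, x, y, ρ c, εlow c)
-- replaced by integer variables, which the ring solver can work with.
NCommonℤ : (A B C R : ℤ) (ε̲ : ℤ → ℤ) → ℤ⁷ → Set
NCommonℤ A B C R ε̲ (k , m , n , ε , α , β , i) =
  0ℤ ≤ k × 0ℤ ≤ m × 0ℤ ≤ n × Bit ε ×
  m ≤ α × α ≤ m + n ×
  ε̲ ε ≤ β × β ≤ m ×
  0ℤ ≤ i × i ≤ ((α - β) ⊓ (k - + 2 * m - n + α + β - ε)) ×
  + 2 * m + R ≡ + 2 * A - C ×
  + 2 * α + k - n - + 2 * m - ε - + 2 * i ≡ B ×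
  + 2 * β + + 2 * i + R ≡ C

NSet₁ℤ : (A B C X Y R : ℤ) (ε̲ : ℤ → ℤ) → ℤ⁷ → Set
NSet₁ℤ A B C X Y R ε̲ t@(k , m , n , _) =
  NCommonℤ A B C R ε̲ t × k ≡ C - A + X × + 2 * m + + 2 * n + R ≡ C + + 2 * Y

NSet₂ℤ : (A B C X Y R : ℤ) (ε̲ : ℤ → ℤ) → ℤ⁷ → Set
NSet₂ℤ A B C X Y R ε̲ t@(k , m , n , _) =
  NCommonℤ A B C R ε̲ t × k ≡ A - C + X × + 2 * m + + 2 * n + R ≡ + 2 * A - C + + 2 * Y

module NSetBijections (R : ℤ) (ε̲ : ℤ → ℤ)
  (ε̲-≤⇔ : ∀ {ε β} → Bit ε → ε̲ ε ≤ β ⇔ ε ≤ + 2 * β + R)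
  (ε̲-nonneg : ∀ {ε} → Bit ε → 0ℤ ≤ ε̲ ε) where

  module Case₁ where

    to-∈ : ∀ {A B C Q X Y h ε e f} → C ≡ + 2 * Q + R → A ≤ C →
      Halved (MSetℤ (+ 2 * A - C) B X Y) (h , ε , e , f) →
      NSet₁ℤ A B C X Y R ε̲ (C - A + X , A - Q - R , C - A + Y , ε , Q + e , Q - (h + C - A) , h + C - A)
    to-∈ {A} {B} {C} {Q} {h = h} {ε} {e} {f} refl A≤C (bit , 0≤d , 0≤e , 0≤f , d≤D , e≤B , refl , refl) =
      ( 0≤-by-≡ (+-mono-≤ 0≤C-A (+-mono-≤ (+-mono-≤ (i≤j⇒0≤j-i e≤B) 0≤d) 0≤f)) (solve (A ∷ B ∷ Q ∷ R ∷ h ∷ ε ∷ e ∷ f ∷ []))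
      , 0≤-by-≡ (+-mono-≤ 0≤β 0≤h) (solve (A ∷ Q ∷ R ∷ h ∷ []))
      , 0≤-by-≡ (+-mono-≤ 0≤C-A (+-mono-≤ 0≤e 0≤f)) (solve (A ∷ Q ∷ R ∷ e ∷ f ∷ []))
      , bit
      , ≤-by-gap (+-mono-≤ 0≤C-A 0≤e) (solve (A ∷ Q ∷ R ∷ e ∷ []))
      , ≤-by-gap 0≤f (solve (A ∷ Q ∷ R ∷ e ∷ f ∷ []))
      , ε̲≤β
      , ≤-by-gap 0≤h (solve (A ∷ Q ∷ R ∷ h ∷ []))
      , 0≤-by-≡ (+-mono-≤ 0≤h 0≤C-A) (solve (A ∷ Q ∷ R ∷ h ∷ []))
      , ≤-⊓-by-gaps 0≤e (solve (A ∷ Q ∷ R ∷ h ∷ e ∷ []))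
          (i≤j⇒0≤j-i e≤B) (solve (A ∷ B ∷ Q ∷ R ∷ h ∷ ε ∷ e ∷ f ∷ []))
      , solve (A ∷ Q ∷ R ∷ [])
      , solve (A ∷ B ∷ Q ∷ R ∷ h ∷ ε ∷ e ∷ f ∷ [])
      , solve (A ∷ Q ∷ R ∷ h ∷ [])
      ) , refl , solve (A ∷ Q ∷ R ∷ e ∷ f ∷ [])
      where
      0≤C-A : 0ℤ ≤ C - A
      0≤C-A = i≤j⇒0≤j-i A≤C
      0≤h : 0ℤ ≤ h
      0≤h = 0≤2i+bit⇒0≤i bit 0≤d
      ε̲≤β : ε̲ ε ≤ Q - (h + C - A)
      ε̲≤β = Equivalence.from (ε̲-≤⇔ {β = Q - (h + C - A)} bit)
        (≤-by-gap (i≤j⇒0≤j-i d≤D) (solve (A ∷ Q ∷ R ∷ h ∷ ε ∷ [])))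
      0≤β : 0ℤ ≤ Q - (h + C - A)
      0≤β = ≤-trans (ε̲-nonneg bit) ε̲≤β

    determined : ∀ {A B C Q X Y k m n ε α β i} → C ≡ + 2 * Q + R →
      NSet₁ℤ A B C X Y R ε̲ (k , m , n , ε , α , β , i) →
      k ≡ C - A + X × m ≡ A - Q - R × n ≡ C - A + Y × β ≡ Q - i
    determined {A} {C = C} {Q} {Y = Y} {m = m} {n} {β = β} {i} refl
      ((_ , _ , _ , _ , _ , _ , _ , _ , _ , _ , m-eq , _ , β-eq) , k-eq , n-eq)
      with refl ← 2m+r≡2a-c⇒m≡a-q-r {A} {Q} {R} {m} m-eq =
      k-eq , refl , 2*-injective n-eq′ , 2β+2i+r≡c⇒β≡q-i {Q} {R} {β} {i} β-eq
      where
      open ≡-Reasoning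
      n-eq′ : + 2 * n ≡ + 2 * (C - A + Y)
      n-eq′ = begin
        + 2 * n                                              ≡⟨ solve (A ∷ Q ∷ R ∷ n ∷ []) ⟩
        + 2 * (A - Q - R) + + 2 * n + R - C + + 2 * (C - A)  ≡⟨ cong (λ z → z - C + + 2 * (C - A)) n-eq ⟩
        C + + 2 * Y - C + + 2 * (C - A)                      ≡⟨ solve (A ∷ Q ∷ R ∷ Y ∷ []) ⟩
        + 2 * (C - A + Y)                                    ∎

    from-∈-determined : ∀ {A B C Q X Y k m n ε α β i} →
      k ≡ C - A + X × m ≡ A - Q - R × n ≡ C - A + Y × β ≡ Q - i → C ≡ + 2 * Q + R →
      NSet₁ℤ A B C X Y R ε̲ (k , m , n , ε , α , β , i) →
      Halved (MSetℤ (+ 2 * A - C) B X Y) (i + A - C , ε , α - β - i , m + n - α)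
    from-∈-determined {A} {C = C} {Q} {X} {Y} {ε = ε} {α} {i = i} (refl , refl , refl , refl) refl
      ((_ , _ , _ , bit , _ , α≤m+n , ε̲≤β , β≤m , _ , i≤⊓ , _ , refl , _) , _) =
      bit
      , 0≤-by-≡ (+-mono-≤ (+-mono-≤ (i≤j⇒0≤j-i β≤m) (i≤j⇒0≤j-i β≤m)) (bit-nonneg bit)) (solve (A ∷ Q ∷ R ∷ ε ∷ i ∷ []))
      , i≤j⇒0≤j-i (≤-trans i≤⊓ (i⊓j≤i _ _))
      , i≤j⇒0≤j-i α≤m+n
      , ≤-by-gap (i≤j⇒0≤j-i (Equivalence.to (ε̲-≤⇔ bit) ε̲≤β)) (solve (A ∷ Q ∷ R ∷ ε ∷ i ∷ []))
      , ≤-by-gap (i≤j⇒0≤j-i (≤-trans i≤⊓ (i⊓j≤j _ _))) (solve (A ∷ Q ∷ R ∷ X ∷ Y ∷ ε ∷ α ∷ i ∷ []))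
      , solve (A ∷ Q ∷ R ∷ X ∷ Y ∷ ε ∷ α ∷ i ∷ [])
      , solve (A ∷ Q ∷ R ∷ Y ∷ α ∷ i ∷ [])

    from∘to : ∀ {A B C Q X Y h ε e f} → C ≡ + 2 * Q + R → Halved (MSetℤ (+ 2 * A - C) B X Y) (h , ε , e , f) →
      ((h + C - A) + A - C , ε , (Q + e) - (Q - (h + C - A)) - (h + C - A) , (A - Q - R) + (C - A + Y) - (Q + e))
      ≡ (h , ε , e , f)
    from∘to {A} {C = C} {Q} {h = h} {e = e} {f} refl (_ , _ , _ , _ , _ , _ , _ , refl) =
      solve (A ∷ Q ∷ R ∷ h ∷ []) ,≡ refl ,≡ solve (A ∷ Q ∷ R ∷ h ∷ e ∷ []) ,≡ solve (A ∷ Q ∷ R ∷ e ∷ f ∷ [])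

    to∘from-determined : ∀ {A C Q X Y k m n ε α β i : ℤ} →
      k ≡ C - A + X × m ≡ A - Q - R × n ≡ C - A + Y × β ≡ Q - i → C ≡ + 2 * Q + R →
      (C - A + X , A - Q - R , C - A + Y , ε , Q + (α - β - i) , Q - ((i + A - C) + C - A) , (i + A - C) + C - A)
      ≡ (k , m , n , ε , α , β , i)
    to∘from-determined {A} {C = C} {Q} {α = α} {i = i} (refl , refl , refl , refl) refl =
      refl ,≡ refl ,≡ refl ,≡ refl ,≡ solve (Q ∷ α ∷ i ∷ []) ,≡ solve (A ∷ Q ∷ R ∷ i ∷ []) ,≡ solve (A ∷ Q ∷ R ∷ i ∷ [])

    bijection : ∀ {A B C Q X Y} → C ≡ + 2 * Q + R → A ≤ C →
      Halved (MSetℤ (+ 2 * A - C) B X Y) ↔ₚ NSet₁ℤ A B C X Y R ε̲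
    bijection {A} {B} {C} {Q} {X} {Y} C≡ A≤C = record
      { to      = λ (h , ε , e , f) → C - A + X , A - Q - R , C - A + Y , ε , Q + e , Q - (h + C - A) , h + C - A
      ; from    = λ (k , m , n , ε , α , β , i) → i + A - C , ε , α - β - i , m + n - α
      ; to-∈    = λ {(h , ε , e , f)} → to-∈ {A} {B} {C} {Q} {X} {Y} {h} {ε} {e} {f} C≡ A≤C
      ; from-∈  = λ p → from-∈-determined (determined {A} {B} {C} {Q} {X} {Y} C≡ p) C≡ p
      ; from∘to = λ {(h , ε , e , f)} → from∘to {A} {B} {C} {Q} {X} {Y} {h} {ε} {e} {f} C≡
      ; to∘from = λ p → to∘from-determined (determined {A} {B} {C} {Q} {X} {Y} C≡ p) C≡
      }

  module Case₂ where

    to-∈ : ∀ {A B C Q X Y h ε e f} → C ≡ + 2 * Q + R → C ≤ A →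
      Halved (MSetℤ C (- A + B + C) X Y) (h , ε , e , f) →
      NSet₂ℤ A B C X Y R ε̲ (A - C + X , A - Q - R , Y , ε , e + (A - Q - R) , Q - h , h)
    to-∈ {A} {B} {C} {Q} {h = h} {ε} {e} {f} refl C≤A (bit , 0≤d , 0≤e , 0≤f , d≤C , e≤O , refl , refl) =
      ( 0≤-by-≡ (+-mono-≤ (+-mono-≤ (i≤j⇒0≤j-i e≤O) 0≤A-C) (+-mono-≤ 0≤d 0≤f)) (solve (A ∷ B ∷ Q ∷ R ∷ h ∷ ε ∷ e ∷ f ∷ []))
      , 0≤-by-≡ (+-mono-≤ (+-mono-≤ 0≤β 0≤A-C) 0≤h) (solve (A ∷ Q ∷ R ∷ h ∷ []))
      , +-mono-≤ 0≤e 0≤f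
      , bit
      , ≤-by-gap 0≤e (solve (A ∷ Q ∷ R ∷ e ∷ []))
      , ≤-by-gap 0≤f (solve (A ∷ Q ∷ R ∷ e ∷ f ∷ []))
      , ε̲≤β
      , ≤-by-gap (+-mono-≤ 0≤A-C 0≤h) (solve (A ∷ Q ∷ R ∷ h ∷ []))
      , 0≤h
      , ≤-⊓-by-gaps (+-mono-≤ 0≤e 0≤A-C) (solve (A ∷ Q ∷ R ∷ h ∷ e ∷ []))
          (i≤j⇒0≤j-i e≤O) (solve (A ∷ B ∷ Q ∷ R ∷ h ∷ ε ∷ e ∷ f ∷ []))
      , solve (A ∷ Q ∷ R ∷ [])
      , solve (A ∷ B ∷ Q ∷ R ∷ h ∷ ε ∷ e ∷ f ∷ [])
      , solve (Q ∷ R ∷ h ∷ [])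
      ) , refl , solve (A ∷ Q ∷ R ∷ e ∷ f ∷ [])
      where
      0≤A-C : 0ℤ ≤ A - C
      0≤A-C = i≤j⇒0≤j-i C≤A
      0≤h : 0ℤ ≤ h
      0≤h = 0≤2i+bit⇒0≤i bit 0≤d
      ε̲≤β : ε̲ ε ≤ Q - h
      ε̲≤β = Equivalence.from (ε̲-≤⇔ {β = Q - h} bit) (≤-by-gap (i≤j⇒0≤j-i d≤C) (solve (Q ∷ R ∷ h ∷ ε ∷ [])))
      0≤β : 0ℤ ≤ Q - h
      0≤β = ≤-trans (ε̲-nonneg bit) ε̲≤β

    determined : ∀ {A B C Q X Y k m n ε α β i} → C ≡ + 2 * Q + R →
      NSet₂ℤ A B C X Y R ε̲ (k , m , n , ε , α , β , i) →
      k ≡ A - C + X × m ≡ A - Q - R × n ≡ Y × β ≡ Q - i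
    determined {A} {C = C} {Q} {Y = Y} {m = m} {n} {β = β} {i} refl
      ((_ , _ , _ , _ , _ , _ , _ , _ , _ , _ , m-eq , _ , β-eq) , k-eq , n-eq)
      with refl ← 2m+r≡2a-c⇒m≡a-q-r {A} {Q} {R} {m} m-eq =
      k-eq , refl , 2*-injective n-eq′ , 2β+2i+r≡c⇒β≡q-i {Q} {R} {β} {i} β-eq
      where
      open ≡-Reasoning
      n-eq′ : + 2 * n ≡ + 2 * Y
      n-eq′ = begin
        + 2 * n                                                  ≡⟨ solve (A ∷ Q ∷ R ∷ n ∷ []) ⟩
        + 2 * (A - Q - R) + + 2 * n + R - + 2 * (A - Q - R) - R  ≡⟨ cong (λ z → z - + 2 * (A - Q - R) - R) n-eq ⟩
        + 2 * A - C + + 2 * Y - + 2 * (A - Q - R) - R            ≡⟨ solve (A ∷ Q ∷ R ∷ Y ∷ []) ⟩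
        + 2 * Y                                                  ∎

    from-∈-determined : ∀ {A B C Q X Y k m n ε α β i} →
      k ≡ A - C + X × m ≡ A - Q - R × n ≡ Y × β ≡ Q - i → C ≡ + 2 * Q + R →
      NSet₂ℤ A B C X Y R ε̲ (k , m , n , ε , α , β , i) →
      Halved (MSetℤ C (- A + B + C) X Y) (i , ε , α - m , m + n - α)
    from-∈-determined {A} {C = C} {Q} {X} {Y} {ε = ε} {α} {i = i} (refl , refl , refl , refl) refl
      ((_ , _ , _ , bit , m≤α , α≤m+n , ε̲≤β , _ , 0≤i , i≤⊓ , _ , refl , _) , _) =
      bit
      , 0≤-by-≡ (+-mono-≤ (+-mono-≤ 0≤i 0≤i) (bit-nonneg bit)) (solve (ε ∷ i ∷ []))
      , i≤j⇒0≤j-i m≤α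
      , i≤j⇒0≤j-i α≤m+n
      , ≤-by-gap (i≤j⇒0≤j-i (Equivalence.to (ε̲-≤⇔ bit) ε̲≤β)) (solve (Q ∷ R ∷ ε ∷ i ∷ []))
      , ≤-by-gap (i≤j⇒0≤j-i (≤-trans i≤⊓ (i⊓j≤j _ _))) (solve (A ∷ Q ∷ R ∷ X ∷ Y ∷ ε ∷ α ∷ i ∷ []))
      , solve (A ∷ Q ∷ R ∷ X ∷ Y ∷ ε ∷ α ∷ i ∷ [])
      , solve (A ∷ Q ∷ R ∷ Y ∷ α ∷ [])

    from∘to : ∀ {A B C Q X Y h ε e f} → C ≡ + 2 * Q + R → Halved (MSetℤ C (- A + B + C) X Y) (h , ε , e , f) →
      (h , ε , (e + (A - Q - R)) - (A - Q - R) , (A - Q - R) + Y - (e + (A - Q - R))) ≡ (h , ε , e , f)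
    from∘to {A} {Q = Q} {e = e} {f} refl (_ , _ , _ , _ , _ , _ , _ , refl) =
      refl ,≡ refl ,≡ solve (A ∷ Q ∷ R ∷ e ∷ []) ,≡ solve (A ∷ Q ∷ R ∷ e ∷ f ∷ [])

    to∘from-determined : ∀ {A C Q X Y k m n ε α β i : ℤ} →
      k ≡ A - C + X × m ≡ A - Q - R × n ≡ Y × β ≡ Q - i →
      (A - C + X , A - Q - R , Y , ε , (α - m) + (A - Q - R) , Q - i , i) ≡ (k , m , n , ε , α , β , i)
    to∘from-determined {A} {Q = Q} {α = α} (refl , refl , refl , refl) =
      refl ,≡ refl ,≡ refl ,≡ refl ,≡ solve (A ∷ Q ∷ R ∷ α ∷ []) ,≡ refl ,≡ refl

    bijection : ∀ {A B C Q X Y} → C ≡ + 2 * Q + R → C ≤ A →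
      Halved (MSetℤ C (- A + B + C) X Y) ↔ₚ NSet₂ℤ A B C X Y R ε̲
    bijection {A} {B} {C} {Q} {X} {Y} C≡ C≤A = record
      { to      = λ (h , ε , e , f) → A - C + X , A - Q - R , Y , ε , e + (A - Q - R) , Q - h , h
      ; from    = λ (k , m , n , ε , α , β , i) → i , ε , α - m , m + n - α
      ; to-∈    = λ {(h , ε , e , f)} → to-∈ {A} {B} {C} {Q} {X} {Y} {h} {ε} {e} {f} C≡ C≤A
      ; from-∈  = λ p → from-∈-determined {A} {B} {C} {Q} {X} {Y} (determined {A} {B} {C} {Q} {X} {Y} C≡ p) C≡ p
      ; from∘to = λ {(h , ε , e , f)} → from∘to {A} {B} {C} {Q} {X} {Y} {h} {ε} {e} {f} C≡
      ; to∘from = λ p → to∘from-determined {A} {C} {Q} {X} {Y} (determined {A} {B} {C} {Q} {X} {Y} C≡ p)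
      }

bit≤β⇔bit≤2β : ∀ {ε β} → Bit ε → ε ≤ β ⇔ ε ≤ + 2 * β + 0ℤ
bit≤β⇔bit≤2β {ε} {β} bit = mk⇔ double (halve bit)
  where
  double : ε ≤ β → ε ≤ + 2 * β + 0ℤ
  double ε≤β = ≤-by-gap (+-mono-≤ (i≤j⇒0≤j-i ε≤β) (≤-trans (bit-nonneg bit) ε≤β)) (solve (ε ∷ β ∷ []))
  halve : ∀ {ε} → Bit ε → ε ≤ + 2 * β + 0ℤ → ε ≤ β
  halve (inj₁ refl) = 0≤2i+bit⇒0≤i {β} (inj₁ refl)
  halve (inj₂ refl) 1≤2β =
    0≤i-j⇒j≤i (0≤2i+bit⇒0≤i {β - 1ℤ} (inj₂ refl) (0≤-by-≡ (i≤j⇒0≤j-i 1≤2β) (solve (β ∷ []))))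

0≤β⇔bit≤2β+1 : ∀ {ε β} → Bit ε → 0ℤ ≤ β ⇔ ε ≤ + 2 * β + 1ℤ
0≤β⇔bit≤2β+1 {ε} {β} bit = mk⇔ (double bit) halve
  where
  double : ∀ {ε} → Bit ε → 0ℤ ≤ β → ε ≤ + 2 * β + 1ℤ
  double (inj₁ refl) 0≤β = ≤-by-gap (+-mono-≤ (+-mono-≤ 0≤β 0≤β) (ℤ.+≤+ (z≤n {n = 1}))) (solve (β ∷ []))
  double (inj₂ refl) 0≤β = ≤-by-gap (+-mono-≤ 0≤β 0≤β) (solve (β ∷ []))
  halve : ε ≤ + 2 * β + 1ℤ → 0ℤ ≤ β
  halve ε≤2β+1 = 0≤2i+1⇒0≤i β (≤-trans (bit-nonneg bit) ε≤2β+1)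

εlow-≤⇔ : ∀ c {ε β} → Bit ε → εlow c ε ≤ β ⇔ ε ≤ + 2 * β + ρ c
εlow-≤⇔ c bit with c % 2 | m%n<n c 2
... | 0 | _ = bit≤β⇔bit≤2β bit
... | 1 | _ = 0≤β⇔bit≤2β+1 bit
... | suc (suc _) | s≤s (s≤s ())

εlow-nonneg : ∀ c {ε} → Bit ε → 0ℤ ≤ εlow c ε
εlow-nonneg c bit with c % 2
... | zero = bit-nonneg bit
... | suc _ = ℤ.+≤+ z≤n

c≡2[c/2]+ρc : ∀ c → + c ≡ + 2 * (+ c /ℕ 2) + ρ c
c≡2[c/2]+ρc c = d≡2*[d/2]+d%2 (+ c)

proposition3p5 : (a b c : ℕ) → (h : Case a b c) → (x y : ℕ) →
    ∃ λ N → HasCount (MSet a b c h x y) N × HasCount (NSet a b c h x y) N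
proposition3p5 a b c (inj₁ (a≤c , _)) x y =
  let N , m-count = MSetℤ-count (+ 2 * + a - + c) (+ b) (+ x) (+ y)
      bijection = Case₁.bijection {+ a} {+ b} {+ c} {+ c /ℕ 2} {+ x} {+ y} (c≡2[c/2]+ρc c) (ℤ.+≤+ a≤c)
  in N , m-count , HasCount-↔ₚ (↔ₚ-trans halving bijection) m-count
  where open NSetBijections (ρ c) (εlow c) (εlow-≤⇔ c) (εlow-nonneg c)
proposition3p5 a b c (inj₂ (c<a , _)) x y =
  let N , m-count = MSetℤ-count (+ c) (- + a + + b + + c) (+ x) (+ y)
      bijection = Case₂.bijection {+ a} {+ b} {+ c} {+ c /ℕ 2} {+ x} {+ y} (c≡2[c/2]+ρc c) (ℤ.+≤+ (<⇒≤ c<a))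
  in N , m-count , HasCount-↔ₚ (↔ₚ-trans halving bijection) m-count
  where open NSetBijections (ρ c) (εlow c) (εlow-≤⇔ c) (εlow-nonneg c)
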